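{- As formal power series in $q$ (equivalently, as analytic functions for $|q|<1$), \[ \sum_{n_1,n_2\ge0}\frac{q^{2n_1^2+6n_1n_2+6n_2^2}}{(q;q)_{n_1}(q^3;q^3)_{n_2}} =\sum_{n_1,n_2\ge0}\frac{q^{2n_1^2+6n_1n_2+6n_2^2+n_1}}{(q;q)_{n_1}(q^3;q^3)_{n_2}} +\sum_{n_1,n_2\ge0}\frac{q^{2n_1^2+6n_1n_2+6n_2^2+4n_1+6n_2+2}}{(q;q)_{n_1}(q^3;q^3)_{n_2}}. \]
   Context: $(z;q)_j=\prod_{0\le t<j}(1-zq^t)$ denotes the $q$-Pochhammer symbol. -}

module Defs where

open import Data.Nat using (ℕ; zero; suc; _+_; _*_; _∸_; _<ᵇ_)
open import Data.Nat.Divisibility using (_∣?_)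
open import Data.Bool using (if_then_else_)
open import Relation.Nullary.Decidable using (⌊_⌋)

-- Formal power series in q with coefficients in ℕ: f n = coefficient of q^n.
-- (All series below have nonnegative integer coefficients; ℕ[[q]] embeds in ℤ[[q]].)
Series : Set
Series = ℕ → ℕ

sumBelow : ℕ → (ℕ → ℕ) → ℕ
sumBelow zero    f = 0
sumBelow (suc n) f = sumBelow n f + f n

one : Series
one zero    = 1
one (suc _) = 0

_⊛_ : Series → Series → Series
(f ⊛ g) n = sumBelow (suc n) (λ k → f k * g (n ∸ k))

shift : ℕ → Series → Series
shift e f n = if n <ᵇ e then 0 else f (n ∸ e)

-- 1 / (1 - q^k) = Σ_{j ≥ 0} q^{k j}   (used only with k ≥ 1)
geom : ℕ → Series
geom k n = if ⌊ k ∣? n ⌋ then 1 else 0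

-- 1 / (q^a ; q^a)_n = ∏_{0 ≤ t < n} 1 / (1 - q^{a (t+1)})
invPoch : ℕ → ℕ → Series
invPoch a zero    = one
invPoch a (suc n) = invPoch a n ⊛ geom (a * suc n)

-- Coefficient of q^N in  Σ_{n1,n2 ≥ 0} q^{E n1 n2} / ((q;q)_{n1} (q^3;q^3)_{n2}).
-- For the exponents used here E n1 n2 ≥ n1 + n2, so only n1, n2 ≤ N contribute;
-- the truncation to n1, n2 ≤ N is therefore exact.
doubleSum : (ℕ → ℕ → ℕ) → Series
doubleSum E N =
  sumBelow (suc N) (λ n1 → sumBelow (suc N) (λ n2 →
    shift (E n1 n2) (invPoch 1 n1 ⊛ invPoch 3 n2) N))

E₀ E₁ E₂ : ℕ → ℕ → ℕ
E₀ n1 n2 = 2 * n1 * n1 + 6 * n1 * n2 + 6 * n2 * n2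
E₁ n1 n2 = 2 * n1 * n1 + 6 * n1 * n2 + 6 * n2 * n2 + n1
E₂ n1 n2 = 2 * n1 * n1 + 6 * n1 * n2 + 6 * n2 * n2 + 4 * n1 + 6 * n2 + 2

{-# OPTIONS --safe #-}
-- Since 1/(1 - q^{n+1}) = 1 + q^{n+1}/(1 - q^{n+1}), we have
--   1/(q;q)_{n+1} = 1/(q;q)_n + q^{n+1}/(q;q)_{n+1}.
-- Applied to the summand with n1 = n+1 on the left, this splits it into the
-- (n, n2) summand of the third series and the (n+1, n2) summand of the second,
-- because E₀(n+1, n2) = E₂(n, n2) and E₀(n+1, n2) + (n+1) = E₁(n+1, n2).
-- Summing over n1 telescopes; the n1 = 0 summands of the first two series agree.
module Submission where

open import Defs
open import Data.Nat using (ℕ; zero; suc; _+_; _*_; _∸_; _<ᵇ_; _<_; _<?_; s≤s⁻¹)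
open import Data.Nat.Properties
open import Data.Nat.Divisibility using (_∣_; _∣?_; ∣-refl; _∣0; ∣m+n∣m⇒∣n; ∣m∣n⇒∣m+n; >⇒∤)
open import Data.Nat.Tactic.RingSolver using (solve-∀)
open import Data.Bool using (true; false; T)
open import Data.Empty using (⊥-elim)
open import Relation.Nullary using (yes; no; ¬_)
open import Relation.Binary.PropositionalEquality

private
  variable
    f g h : Series

_⊕_ : Series → Series → Series
(f ⊕ g) n = f n + g n

sumBelow-cong : ∀ n {f g : ℕ → ℕ} → (∀ i → i < n → f i ≡ g i) → sumBelow n f ≡ sumBelow n g
sumBelow-cong zero    f≡g = refl
sumBelow-cong (suc n) f≡g =
  cong₂ _+_ (sumBelow-cong n (λ i i<n → f≡g i (m<n⇒m<1+n i<n))) (f≡g n (n<1+n n))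

sumBelow-zeros : ∀ n {f : ℕ → ℕ} → (∀ i → i < n → f i ≡ 0) → sumBelow n f ≡ 0
sumBelow-zeros zero    f≡0 = refl
sumBelow-zeros (suc n) f≡0 =
  cong₂ _+_ (sumBelow-zeros n (λ i i<n → f≡0 i (m<n⇒m<1+n i<n))) (f≡0 n (n<1+n n))

sumBelow-distrib-+ : ∀ n (f g : ℕ → ℕ) →
                     sumBelow n (λ i → f i + g i) ≡ sumBelow n f + sumBelow n g
sumBelow-distrib-+ zero    f g = refl
sumBelow-distrib-+ (suc n) f g
  rewrite sumBelow-distrib-+ n f g = interchange (sumBelow n f) (sumBelow n g) (f n) (g n)
  where
  interchange : ∀ a b c d → a + b + (c + d) ≡ a + c + (b + d)
  interchange = solve-∀

sumBelow-+ : ∀ m n (f : ℕ → ℕ) →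
             sumBelow (m + n) f ≡ sumBelow m f + sumBelow n (λ i → f (m + i))
sumBelow-+ m zero    f rewrite +-identityʳ m = sym (+-identityʳ _)
sumBelow-+ m (suc n) f rewrite +-suc m n | sumBelow-+ m n f =
  +-assoc (sumBelow m f) (sumBelow n (λ i → f (m + i))) (f (m + n))

sumBelow-suc : ∀ n (f : ℕ → ℕ) → sumBelow (suc n) f ≡ f 0 + sumBelow n (λ i → f (suc i))
sumBelow-suc n f = sumBelow-+ 1 n f

sumBelow-reverse : ∀ n (f : ℕ → ℕ) → sumBelow (suc n) f ≡ sumBelow (suc n) (λ i → f (n ∸ i))
sumBelow-reverse zero    f = refl
sumBelow-reverse (suc n) f = begin
  sumBelow (suc n) f + f (suc n)                      ≡⟨ cong (_+ f (suc n)) (sumBelow-reverse n f) ⟩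
  sumBelow (suc n) (λ i → f (n ∸ i)) + f (suc n)      ≡⟨ +-comm _ (f (suc n)) ⟩
  f (suc n) + sumBelow (suc n) (λ i → f (n ∸ i))      ≡⟨ sumBelow-suc (suc n) (λ i → f (suc n ∸ i)) ⟨
  sumBelow (suc (suc n)) (λ i → f (suc n ∸ i))        ∎
  where open ≡-Reasoning

telescope : (a b c : ℕ → ℕ) → a 0 ≡ b 0 → (∀ n → a (suc n) ≡ c n + b (suc n)) →
            ∀ n → sumBelow (suc n) a ≡ sumBelow (suc n) b + sumBelow n c
telescope a b c a₀ aₛ zero    = trans (cong (0 +_) a₀) (sym (+-identityʳ _))
telescope a b c a₀ aₛ (suc n) = begin
  sumBelow (suc n) a + a (suc n)                      ≡⟨ cong₂ _+_ (telescope a b c a₀ aₛ n) (aₛ n) ⟩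
  (B + C) + (c n + b (suc n))                         ≡⟨ rearrange B C (c n) (b (suc n)) ⟩
  (B + b (suc n)) + (C + c n)                         ∎
  where
  open ≡-Reasoning
  B = sumBelow (suc n) b
  C = sumBelow n c
  rearrange : ∀ w x y z → (w + x) + (y + z) ≡ (w + z) + (x + y)
  rearrange = solve-∀

data Cut (e : ℕ) : ℕ → Set where
  below : ∀ {m} → m < e → Cut e m
  above : ∀ d → Cut e (e + d)

cut : ∀ e m → Cut e m
cut e m with m <? e
... | yes m<e = below m<e
... | no  m≮e = subst (Cut e) (m+[n∸m]≡n (≮⇒≥ m≮e)) (above (m ∸ e))

shift-< : ∀ e f {m} → m < e → shift e f m ≡ 0
shift-< e f {m} m<e with m <ᵇ e | <⇒<ᵇ m<e
... | true | _ = refl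

shift-+ : ∀ e f m → shift e f (e + m) ≡ f m
shift-+ e f m with (e + m) <ᵇ e in eq
... | true  = ⊥-elim (<⇒≱ (<ᵇ⇒< (e + m) e (subst T (sym eq) _)) (m≤m+n e m))
... | false = cong f (m+n∸m≡n e m)

shift-cong : ∀ e → f ≗ g → shift e f ≗ shift e g
shift-cong e f≗g m with m <ᵇ e
... | true  = refl
... | false = f≗g (m ∸ e)

shift-distrib-⊕ : ∀ e f g → shift e (f ⊕ g) ≗ shift e f ⊕ shift e g
shift-distrib-⊕ e f g m with m <ᵇ e
... | true  = refl
... | false = refl

shift-shift : ∀ e k g → shift e (shift k g) ≗ shift (e + k) g
shift-shift e k g m with cut e m
... | below m<e
  rewrite shift-< e (shift k g) m<e | shift-< (e + k) g (<-≤-trans m<e (m≤m+n e k)) = refl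
... | above d with cut k d
...   | below d<k
  rewrite shift-+ e (shift k g) d | shift-< k g d<k
        | shift-< (e + k) g (+-monoʳ-< e d<k) = refl
...   | above c
  rewrite shift-+ e (shift k g) (k + c) | shift-+ k g c
        | sym (+-assoc e k c) | shift-+ (e + k) g c = refl

⊛-congˡ : ∀ g → f ≗ h → f ⊛ g ≗ h ⊛ g
⊛-congˡ g f≗h n = sumBelow-cong (suc n) (λ i _ → cong (_* g (n ∸ i)) (f≗h i))

⊛-comm : ∀ f g → f ⊛ g ≗ g ⊛ f
⊛-comm f g n = trans (sumBelow-reverse n (λ i → f i * g (n ∸ i)))
  (sumBelow-cong (suc n) (λ i i≤n → trans (*-comm (f (n ∸ i)) _)
    (cong (λ j → g j * f (n ∸ i)) (m∸[m∸n]≡n (s≤s⁻¹ i≤n)))))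

⊛-congʳ : ∀ f → g ≗ h → f ⊛ g ≗ f ⊛ h
⊛-congʳ {g} {h} f g≗h n = trans (⊛-comm f g n) (trans (⊛-congˡ f g≗h n) (⊛-comm h f n))

⊛-identityˡ : ∀ f → one ⊛ f ≗ f
⊛-identityˡ f n = begin
  (one ⊛ f) n                   ≡⟨ sumBelow-suc n _ ⟩
  f n + 0 + sumBelow n (λ _ → 0) ≡⟨ cong (f n + 0 +_) (sumBelow-zeros n (λ _ _ → refl)) ⟩
  f n + 0 + 0                   ≡⟨ cong (_+ 0) (+-identityʳ (f n)) ⟩
  f n + 0                       ≡⟨ +-identityʳ (f n) ⟩
  f n                           ∎
  where open ≡-Reasoning

⊛-identityʳ : ∀ f → f ⊛ one ≗ f
⊛-identityʳ f n = trans (⊛-comm f one n) (⊛-identityˡ f n)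

⊛-distribʳ-⊕ : ∀ h f g → (f ⊕ g) ⊛ h ≗ (f ⊛ h) ⊕ (g ⊛ h)
⊛-distribʳ-⊕ h f g n =
  trans (sumBelow-cong (suc n) (λ i _ → *-distribʳ-+ (h (n ∸ i)) (f i) (g i)))
        (sumBelow-distrib-+ (suc n) (λ i → f i * h (n ∸ i)) (λ i → g i * h (n ∸ i)))

⊛-distribˡ-⊕ : ∀ h f g → h ⊛ (f ⊕ g) ≗ (h ⊛ f) ⊕ (h ⊛ g)
⊛-distribˡ-⊕ h f g n = trans (⊛-comm h (f ⊕ g) n)
  (trans (⊛-distribʳ-⊕ h f g n) (cong₂ _+_ (⊛-comm f h n) (⊛-comm g h n)))

shift-⊛ˡ : ∀ k f h → shift k f ⊛ h ≗ shift k (f ⊛ h)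
shift-⊛ˡ k f h n with cut k n
... | below n<k = trans (sumBelow-zeros (suc n) vanishes) (sym (shift-< k (f ⊛ h) n<k))
  where
  vanishes : ∀ i → i < suc n → shift k f i * h (n ∸ i) ≡ 0
  vanishes i i≤n = cong (_* h (n ∸ i)) (shift-< k f (≤-<-trans (s≤s⁻¹ i≤n) n<k))
... | above d = begin
  sumBelow (suc (k + d)) (λ i → shift k f i * h (k + d ∸ i))
    ≡⟨ cong (λ m → sumBelow m (λ i → shift k f i * h (k + d ∸ i))) (+-suc k d) ⟨
  sumBelow (k + suc d) (λ i → shift k f i * h (k + d ∸ i))
    ≡⟨ sumBelow-+ k (suc d) _ ⟩
  sumBelow k (λ i → shift k f i * h (k + d ∸ i))
    + sumBelow (suc d) (λ i → shift k f (k + i) * h (k + d ∸ (k + i)))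
    ≡⟨ cong₂ _+_ (sumBelow-zeros k (λ i i<k → cong (_* h (k + d ∸ i)) (shift-< k f i<k))) (sumBelow-cong (suc d) (λ i _ →
         cong₂ _*_ (shift-+ k f i) (cong h ([m+n]∸[m+o]≡n∸o k d i)))) ⟩
  0 + (f ⊛ h) d
    ≡⟨ shift-+ k (f ⊛ h) d ⟨
  shift k (f ⊛ h) (k + d) ∎
  where open ≡-Reasoning

shift-⊛ʳ : ∀ k f h → h ⊛ shift k f ≗ shift k (h ⊛ f)
shift-⊛ʳ k f h n =
  trans (⊛-comm h (shift k f) n) (trans (shift-⊛ˡ k f h n) (shift-cong k (⊛-comm f h) n))

geom-∣ : ∀ {k n} → k ∣ n → geom k n ≡ 1
geom-∣ {k} {n} k∣n with k ∣? n
... | yes _  = refl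
... | no k∤n = ⊥-elim (k∤n k∣n)

geom-∤ : ∀ {k n} → ¬ k ∣ n → geom k n ≡ 0
geom-∤ {k} {n} k∤n with k ∣? n
... | yes k∣n = ⊥-elim (k∤n k∣n)
... | no _    = refl

geom-+ : ∀ k n → geom k (k + n) ≡ geom k n
geom-+ k n with k ∣? n
... | yes k∣n = geom-∣ (∣m∣n⇒∣m+n ∣-refl k∣n)
... | no  k∤n = geom-∤ (λ k∣k+n → k∤n (∣m+n∣m⇒∣n k∣k+n ∣-refl))

geom-unfold : ∀ k → geom (suc k) ≗ one ⊕ shift (suc k) (geom (suc k))
geom-unfold k n with cut (suc k) n
... | below n<k rewrite shift-< (suc k) (geom (suc k)) n<k = head n n<k
  where
  head : ∀ n → n < suc k → geom (suc k) n ≡ one n + 0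
  head zero    _   = geom-∣ (suc k ∣0)
  head (suc n) n<k = geom-∤ (>⇒∤ n<k)
... | above d rewrite shift-+ (suc k) (geom (suc k)) d = geom-+ (suc k) d

invPoch-suc : ∀ a n →
  invPoch (suc a) (suc n) ≗ invPoch (suc a) n ⊕ shift (suc a * suc n) (invPoch (suc a) (suc n))
invPoch-suc a n m = begin
  (P ⊛ geom k) m                              ≡⟨ ⊛-congʳ P (geom-unfold (n + a * suc n)) m ⟩
  (P ⊛ (one ⊕ shift k (geom k))) m            ≡⟨ ⊛-distribˡ-⊕ P one (shift k (geom k)) m ⟩
  (P ⊛ one) m + (P ⊛ shift k (geom k)) m      ≡⟨ cong₂ _+_ (⊛-identityʳ P m) (shift-⊛ʳ k (geom k) P m) ⟩
  P m + shift k (P ⊛ geom k) m                ∎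
  where
  open ≡-Reasoning
  P = invPoch (suc a) n
  k = suc a * suc n

invPoch-suc-⊛ : ∀ a n g →
  invPoch (suc a) (suc n) ⊛ g
    ≗ (invPoch (suc a) n ⊛ g) ⊕ shift (suc a * suc n) (invPoch (suc a) (suc n) ⊛ g)
invPoch-suc-⊛ a n g m = begin
  (P′ ⊛ g) m                                  ≡⟨ ⊛-congˡ g (invPoch-suc a n) m ⟩
  ((P ⊕ shift k P′) ⊛ g) m                    ≡⟨ ⊛-distribʳ-⊕ g P (shift k P′) m ⟩
  (P ⊛ g) m + (shift k P′ ⊛ g) m              ≡⟨ cong ((P ⊛ g) m +_) (shift-⊛ˡ k P′ g m) ⟩
  (P ⊛ g) m + shift k (P′ ⊛ g) m              ∎
  where
  open ≡-Reasoning
  P  = invPoch (suc a) n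
  P′ = invPoch (suc a) (suc n)
  k  = suc a * suc n

summand : (ℕ → ℕ → ℕ) → ℕ → ℕ → Series
summand E n₁ n₂ = shift (E n₁ n₂) (invPoch 1 n₁ ⊛ invPoch 3 n₂)

row : (ℕ → ℕ → ℕ) → ℕ → ℕ → ℕ
row E N n₁ = sumBelow (suc N) (λ n₂ → summand E n₁ n₂ N)

E₀-zero : ∀ n₂ → E₀ 0 n₂ ≡ E₁ 0 n₂
E₀-zero n₂ = sym (+-identityʳ (E₀ 0 n₂))

E₀-suc : ∀ n m → E₀ (suc n) m ≡ E₂ n m
E₀-suc = expand
  where
  expand : ∀ n m → 2 * suc n * suc n + 6 * suc n * m + 6 * m * m
                 ≡ 2 * n * n + 6 * n * m + 6 * m * m + 4 * n + 6 * m + 2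
  expand = solve-∀

E₀-suc-+ : ∀ n m → E₀ (suc n) m + 1 * suc n ≡ E₁ (suc n) m
E₀-suc-+ = expand
  where
  expand : ∀ n m → 2 * suc n * suc n + 6 * suc n * m + 6 * m * m + 1 * suc n
                 ≡ 2 * suc n * suc n + 6 * suc n * m + 6 * m * m + suc n
  expand = solve-∀

n<E₂ : ∀ n m → n < E₂ n m
n<E₂ n m = subst (n <_) (sym (expand n m)) (m≤m+n (suc n) _)
  where
  expand : ∀ n m → 2 * n * n + 6 * n * m + 6 * m * m + 4 * n + 6 * m + 2
                 ≡ suc n + (2 * n * n + 6 * n * m + 6 * m * m + 3 * n + 6 * m + 1)
  expand = solve-∀

summand-E₀-suc : ∀ n m → summand E₀ (suc n) m ≗ summand E₂ n m ⊕ summand E₁ (suc n) m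
summand-E₀-suc n m N = begin
  shift e (P′ ⊛ B) N                              ≡⟨ shift-cong e (invPoch-suc-⊛ 0 n B) N ⟩
  shift e ((P ⊛ B) ⊕ shift k (P′ ⊛ B)) N          ≡⟨ shift-distrib-⊕ e (P ⊛ B) (shift k (P′ ⊛ B)) N ⟩
  shift e (P ⊛ B) N + shift e (shift k (P′ ⊛ B)) N ≡⟨ cong (shift e (P ⊛ B) N +_) (shift-shift e k (P′ ⊛ B) N) ⟩
  shift e (P ⊛ B) N + shift (e + k) (P′ ⊛ B) N    ≡⟨ cong₂ (λ x y → shift x (P ⊛ B) N + shift y (P′ ⊛ B) N)
                                                           (E₀-suc n m) (E₀-suc-+ n m) ⟩
  summand E₂ n m N + summand E₁ (suc n) m N       ∎
  where
  open ≡-Reasoning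
  e  = E₀ (suc n) m
  k  = 1 * suc n
  P  = invPoch 1 n
  P′ = invPoch 1 (suc n)
  B  = invPoch 3 m

summand-E₂-diagonal : ∀ N m → summand E₂ N m N ≡ 0
summand-E₂-diagonal N m = shift-< (E₂ N m) (invPoch 1 N ⊛ invPoch 3 m) (n<E₂ N m)

mainTheorem2 : (N : ℕ) → doubleSum E₀ N ≡ doubleSum E₁ N + doubleSum E₂ N
mainTheorem2 N = begin
  doubleSum E₀ N                                        ≡⟨ telescope (row E₀ N) (row E₁ N) (row E₂ N)
                                                             row-zero row-suc N ⟩
  doubleSum E₁ N + sumBelow N (row E₂ N)                ≡⟨ cong (doubleSum E₁ N +_) last-row-vanishes ⟨
  doubleSum E₁ N + doubleSum E₂ N                       ∎
  where
  open ≡-Reasoning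
  row-zero : row E₀ N 0 ≡ row E₁ N 0
  row-zero = sumBelow-cong (suc N) (λ n₂ _ → cong (λ x → shift x (invPoch 1 0 ⊛ invPoch 3 n₂) N) (E₀-zero n₂))
  row-suc : ∀ n → row E₀ N (suc n) ≡ row E₂ N n + row E₁ N (suc n)
  row-suc n = trans (sumBelow-cong (suc N) (λ n₂ _ → summand-E₀-suc n n₂ N))
                    (sumBelow-distrib-+ (suc N) (λ n₂ → summand E₂ n n₂ N) (λ n₂ → summand E₁ (suc n) n₂ N))
  last-row-vanishes : sumBelow (suc N) (row E₂ N) ≡ sumBelow N (row E₂ N)
  last-row-vanishes =
    trans (cong (sumBelow N (row E₂ N) +_) (sumBelow-zeros (suc N) (λ n₂ _ → summand-E₂-diagonal N n₂)))
          (+-identityʳ _)
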